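{- Let $\Pi = (V, \Lambda, \mathfrak{C}, \mathrm{dom}, \mathcal{B})$ be a CSP with locally finite dependency graph $D$, and let $\mathbb{P}$ be a probability measure on $\Lambda$ making $(\Lambda,\mathbb{P})$ a standard probability space. Suppose $\mathbb{P}[\mathcal{B}(\mathfrak{c})] < 1$ for all $\mathfrak{c} \in \mathfrak{C}$ and let $\tau$ be a table. If a labeling $f \in \mathsf{MMTA}(\Pi, \tau)$ is defined on all of $V$, then $f$ is a solution to $\Pi$.
   Context: A CSP $\Pi = (V, \Lambda, \mathfrak{C}, \mathrm{dom}, \mathcal{B})$: sets $V$, $\Lambda$, $\mathfrak{C}$; finite $\mathrm{dom}(\mathfrak{c}) \subseteq V$ and $\mathcal{B}(\mathfrak{c}) \subseteq \Lambda^{\mathrm{dom}(\mathfrak{c})}$ for each constraint; a labeling $f$ violates $\mathfrak{c}$ iff $f|_{\mathrm{dom}(\mathfrak{c})} \in \mathcal{B}(\mathfrak{c})$; a solution violates no constraint. $\mathbb{P}[\mathcal{B}(\mathfrak{c})]$ is with respect to the product measure $\mathbb{P}^{\mathrm{dom}(\mathfrak{c})}$ (note $\Lambda^{\emptyset} = \{\emptyset\}$ has measure $1$). The dependency graph $D$ has vertex set $\mathfrak{C}$, distinct constraints adjacent iff their domains intersect. A table is a map $\tau \colon V \to \Lambda^{\mathbb{N}}$, $\tau(v,n)$ the $n$-th entry of $\tau(v)$. The Moser–Tardos algorithm on input $(\Pi,\tau)$: set $\ell_0 \equiv 0$; for $n=0,1,2,\dots$: let $f_n(v) = \tau(v,\ell_n(v))$,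 let $\mathfrak{C}_n$ be the set of constraints violated by $f_n$, choose a $D$-independent set $\mathcal{I}_n \subseteq \mathfrak{C}_n$, and set $\ell_{n+1}(v) = \ell_n(v)+1$ if $v \in \mathrm{dom}(\mathfrak{c})$ for some $\mathfrak{c}\in\mathcal{I}_n$, else $\ell_{n+1}(v)=\ell_n(v)$. Finally $\ell(v) = \lim_n \ell_n(v) \in \mathbb{N}\cup\{\infty\}$ and the output is the partial labeling $f(v) = \tau(v,\ell(v))$ defined for those $v$ with $\ell(v) < \infty$. The Maximal Moser–Tardos algorithm is the same, except each $\mathcal{I}_n$ must be an inclusion-maximal $D$-independent subset of $\mathfrak{C}_n$. $\mathsf{MMTA}(\Pi,\tau)$ is the set of all partial labelings that can be output by the Maximal Moser–Tardos algorithm on input $(\Pi,\tau)$. -}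

module Defs where

open import Data.Nat using (ℕ; zero; suc; _≤_)
open import Data.List using (List; length)
open import Data.List.Membership.Propositional using (_∈_)
open import Data.List.Relation.Unary.Unique.Propositional using (Unique)
open import Data.Vec using (Vec; fromList; map)
open import Data.Product using (Σ; ∃; ∃-syntax; _×_)
open import Relation.Binary.PropositionalEquality using (_≡_; _≢_)
open import Relation.Nullary using (¬_)

-- The finite domain dom(𝔠) ⊆ V is given as a
-- duplicate-free list of variables; Λ^dom(𝔠) is then identified with
-- Vec Λ (length (dom 𝔠)) (the i-th entry is the label of the i-th variable).
record CSP : Set₁ where
  field
    Var    : Set
    Label  : Set
    Con    : Set
    dom    : Con → List Var
    dom-unique : ∀ c → Unique (dom c)
    Bad    : (c : Con) → Vec Label (length (dom c)) → Set

module _ (Π : CSP) where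
  open CSP Π

  restrict : (Var → Label) → (c : Con) → Vec Label (length (dom c))
  restrict f c = map f (fromList (dom c))

  Violates : (Var → Label) → Con → Set
  Violates f c = Bad c (restrict f c)

  IsSolution : (Var → Label) → Set
  IsSolution f = ∀ c → ¬ Violates f c

  Adjacent : Con → Con → Set
  Adjacent c c' = c ≢ c' × ∃[ v ] (v ∈ dom c × v ∈ dom c')

  LocallyFinite : Set
  LocallyFinite = ∀ c → ∃[ L ] (∀ c' → Adjacent c c' → c' ∈ L)

  Table : Set
  Table = Var → ℕ → Label

  -- a run of the Maximal Moser–Tardos algorithm on (Π, τ):
  -- ℓ n v = ℓ_n(v), I n = 𝓘_n (as a predicate on constraints)
  record MaximalRun (τ : Table) : Set₁ where
    field
      ℓ : ℕ → Var → ℕ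
      I : ℕ → Con → Set
    fₙ : ℕ → Var → Label
    fₙ n v = τ v (ℓ n v)
    field
      ℓ-zero   : ∀ v → ℓ zero v ≡ zero
      I-viol   : ∀ n c → I n c → Violates (fₙ n) c
      I-indep  : ∀ n c c' → I n c → I n c' → ¬ Adjacent c c'
      I-max    : ∀ n c → Violates (fₙ n) c → ¬ I n c → ∃[ c' ] (I n c' × Adjacent c c')
      ℓ-step   : ∀ n v → (∃[ c ] (I n c × v ∈ dom c)) → ℓ (suc n) v ≡ suc (ℓ n v)
      ℓ-stay   : ∀ n v → ¬ (∃[ c ] (I n c × v ∈ dom c)) → ℓ (suc n) v ≡ ℓ n v

  -- f ∈ MMTA(Π, τ) and f is defined on all of V:
  -- some maximal run has ℓ(v) = lim ℓ_n(v) < ∞ for every v, and f(v) = τ(v, ℓ(v)).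
  TotalMMTAOutput : Table → (Var → Label) → Set₁
  TotalMMTAOutput τ f =
    Σ (MaximalRun τ) λ R → ∀ v →
      ∃[ N ] ((∀ n → N ≤ n → MaximalRun.ℓ R n v ≡ MaximalRun.ℓ R N v)
              × f v ≡ τ v (MaximalRun.ℓ R N v))

{-# OPTIONS --safe #-}
-- Choose a time N after which ℓ no longer moves on the finitely many
-- variables of a constraint c; then f agrees with f_N on dom(c), so if f
-- violated c, so would f_N.  By maximality of 𝓘_N, either c itself or a
-- neighbour sharing a variable with c lies in 𝓘_N, and that variable is
-- resampled at step N, which is impossible.  The only escape is dom(c) = ∅,
-- but then every labeling violates c, i.e. ℙ[𝓑(c)] = 1.
module Submission where

open import Defs
open import Data.Nat using (ℕ; suc; _≤_; _⊔_)
open import Data.Nat.Properties using (≤-trans; n≤1+n; 1+n≢n; m≤m⊔n; m≤n⊔m)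
open import Data.List using (List; []; _∷_; length)
open import Data.List.Relation.Unary.Any using (here; there)
open import Data.List.Membership.Propositional using (_∈_)
open import Data.Vec using (Vec)
import Data.Vec as Vec
open import Data.Product using (∃; ∃-syntax; _×_; _,_; proj₁; proj₂)
open import Relation.Nullary using (¬_)
open import Relation.Binary.PropositionalEquality using (_≡_; refl; sym; trans; cong; cong₂; subst)

private
  variable
    A B : Set

map-fromList-cong : {g h : A → B} (xs : List A) → (∀ x → x ∈ xs → g x ≡ h x) →
                    Vec.map g (Vec.fromList xs) ≡ Vec.map h (Vec.fromList xs)
map-fromList-cong []       g≡h = refl
map-fromList-cong (x ∷ xs) g≡h =
  cong₂ Vec._∷_ (g≡h x (here refl)) (map-fromList-cong xs (λ y y∈xs → g≡h y (there y∈xs)))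

∃∈-if-¬universal : (xs : List A) {P : Vec B (length xs) → Set} (w : Vec B (length xs)) →
                   P w → ¬ (∀ w′ → P w′) → ∃[ x ] x ∈ xs
∃∈-if-¬universal []      Vec.[] Pw ¬all with () ← ¬all (λ { Vec.[] → Pw })
∃∈-if-¬universal (x ∷ _) _      _  _    = x , here refl

∃-common-bound : {P : A → ℕ → Set} → (∀ {x m n} → m ≤ n → P x m → P x n) →
                 (xs : List A) → (∀ x → x ∈ xs → ∃ (P x)) → ∃[ N ] (∀ x → x ∈ xs → P x N)
∃-common-bound mono []       bound = 0 , λ _ ()
∃-common-bound mono (x ∷ xs) bound
  with M , Px  ← bound x (here refl)
     | N , Pxs ← ∃-common-bound mono xs (λ y y∈xs → bound y (there y∈xs)) =
  M ⊔ N , λ where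
    _ (here refl) → mono (m≤m⊔n M N) Px
    y (there y∈xs) → mono (m≤n⊔m M N) (Pxs y y∈xs)

StableFrom : (ℕ → A) → ℕ → Set
StableFrom s N = ∀ n → N ≤ n → s n ≡ s N

stableFrom-mono : {s : ℕ → A} {M N : ℕ} → M ≤ N → StableFrom s M → StableFrom s N
stableFrom-mono {N = N} M≤N stable n N≤n = trans (stable n (≤-trans M≤N N≤n)) (sym (stable N M≤N))

module _ (Π : CSP) where
  open CSP Π

  restrict-cong : {g h : Var → Label} (c : Con) → (∀ v → v ∈ dom c → g v ≡ h v) →
                  restrict Π g c ≡ restrict Π h c
  restrict-cong c = map-fromList-cong (dom c)

  violated-constraint-has-variable : {g : Var → Label} (c : Con) → ¬ (∀ w → Bad c w) →
                                     Violates Π g c → ∃[ v ] v ∈ dom c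
  violated-constraint-has-variable {g} c ¬universal violated =
    ∃∈-if-¬universal (dom c) (restrict Π g c) violated ¬universal

  module _ {τ : Table Π} (R : MaximalRun Π τ) where
    open MaximalRun R

    Resampled : ℕ → Var → Set
    Resampled n v = ∃[ c ] (I n c × v ∈ dom c)

    stable⇒¬resampled : {n : ℕ} (v : Var) → StableFrom (λ m → ℓ m v) n → ¬ Resampled n v
    stable⇒¬resampled {n} v stable resampled =
      1+n≢n (trans (sym (ℓ-step n v resampled)) (stable (suc n) (n≤1+n n)))

    violated-constraint-resampled : {n : ℕ} {v : Var} (c : Con) → v ∈ dom c → Violates Π (fₙ n) c →
                                    ¬ (∀ w → w ∈ dom c → ¬ Resampled n w)
    violated-constraint-resampled {n} {v} c v∈c violated untouched
      with c′ , c′∈I , _ , w , w∈c , w∈c′ ← I-max n c violated (λ c∈I → untouched v v∈c (c , c∈I , v∈c)) =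
      untouched w w∈c (c′ , c′∈I , w∈c′)

    Settled : (Var → Label) → Var → ℕ → Set
    Settled f v N = StableFrom (λ n → ℓ n v) N × f v ≡ fₙ N v

    settled-mono : {f : Var → Label} {v : Var} {M N : ℕ} → M ≤ N → Settled f v M → Settled f v N
    settled-mono {v = v} {N = N} M≤N (stable , f≡fₘ) =
      stableFrom-mono M≤N stable , trans f≡fₘ (cong (τ v) (sym (stable N M≤N)))

lemma2p2 : (Π : CSP) → LocallyFinite Π →
    (∀ c → ¬ (∀ (g : Vec (CSP.Label Π) (length (CSP.dom Π c))) → CSP.Bad Π c g)) →
    (τ : Table Π) → (f : CSP.Var Π → CSP.Label Π) →
    TotalMMTAOutput Π τ f → IsSolution Π f
lemma2p2 Π _ ℙ[𝓑]<1 τ f (R , output) c f-violates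
  with N , settled ← ∃-common-bound (settled-mono Π R {f}) (CSP.dom Π c) (λ v _ → output v)
     | v , v∈c     ← violated-constraint-has-variable Π c (ℙ[𝓑]<1 c) f-violates =
  violated-constraint-resampled Π R c v∈c fₙ-violates
    (λ w w∈c → stable⇒¬resampled Π R w (proj₁ (settled w w∈c)))
  where
  fₙ-violates : Violates Π (MaximalRun.fₙ R N) c
  fₙ-violates = subst (CSP.Bad Π c) (restrict-cong Π c (λ w w∈c → proj₂ (settled w w∈c))) f-violates
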